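{- Let $p \geq 2$ and $n \geq p+2$ be integers, and let $T$ be a tournament with vertex set $[n]$. Then $T$ is $(=p)$-invertible if and only if $p$ is even or $|\{i \in [n] \mid d^+(i) \text{ is even}\}| = \lceil n/2 \rceil$.
   Context: For an oriented graph $D$ and $X\subseteq V(D)$, the inversion of $X$ reverses the orientation of every arc with both endpoints in $X$. A $(=p)$-inversion is the inversion of a set of exactly $p$ vertices. An oriented graph is $(=p)$-invertible if it can be made acyclic by a (finite, possibly empty) sequence of $(=p)$-inversions. $d^+(i)$ denotes the out-degree of $i$ in $T$. -}

module Defs where

open import Data.Bool using (Bool; true; false; if_then_else_; _∧_)
open import Data.Nat using (ℕ; zero; suc; _≤_; _+_; ⌈_/2⌉)
open import Data.Nat.Divisibility using (_∣_; _∣?_)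
open import Data.Fin using (Fin; zero; suc; inject₁; fromℕ)
open import Data.Fin.Subset using (Subset; ∣_∣)
open import Data.Vec using (lookup; tabulate)
open import Data.List using (List; foldl)
open import Data.Product using (Σ; ∃; _×_; _,_)
open import Data.Empty using (⊥)
open import Relation.Nullary using (¬_; does)
open import Relation.Binary.PropositionalEquality using (_≡_; _≢_)
open import Function.Definitions using (Injective)

-- A digraph on vertex set Fin n, given by its arc indicator:
-- D i j ≡ true  iff  i → j is an arc.
Digraph : ℕ → Set
Digraph n = Fin n → Fin n → Bool

IsOriented : ∀ {n} → Digraph n → Set
IsOriented {n} D = (∀ i → D i i ≡ false)
                 × (∀ i j → D i j ≡ true → D j i ≡ false)

IsTournament : ∀ {n} → Digraph n → Set
IsTournament {n} D = IsOriented D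
                   × (∀ i j → i ≢ j → (D i j ≡ true) ⊎' (D j i ≡ true))
  where
  open import Data.Sum renaming (_⊎_ to _⊎'_)

invert : ∀ {n} → Subset n → Digraph n → Digraph n
invert X D i j = if lookup X i ∧ lookup X j then D j i else D i j

invertAll : ∀ {n} → List (Subset n) → Digraph n → Digraph n
invertAll Xs D = foldl (λ E X → invert X E) D Xs

-- A directed cycle of length k+2: distinct vertices c 0, …, c (k+1)
-- with arcs c i → c (i+1) and c (k+1) → c 0.
record Cycle {n} (D : Digraph n) : Set where
  field
    k      : ℕ
    c      : Fin (suc (suc k)) → Fin n
    inj    : Injective _≡_ _≡_ c
    step   : ∀ (i : Fin (suc k)) → D (c (inject₁ i)) (c (suc i)) ≡ true
    close  : D (c (fromℕ (suc k))) (c zero) ≡ true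

Acyclic : ∀ {n} → Digraph n → Set
Acyclic D = ¬ Cycle D

Invertible= : ∀ {n} → ℕ → Digraph n → Set
Invertible= {n} p D =
  Σ (List (Subset n)) λ Xs →
    AllSize Xs × Acyclic (invertAll Xs D)
  where
  open import Data.List.Relation.Unary.All using (All)
  AllSize : List (Subset n) → Set
  AllSize Xs = All (λ X → ∣ X ∣ ≡ p) Xs

outdeg : ∀ {n} → Digraph n → Fin n → ℕ
outdeg D i = ∣ tabulate (λ j → D i j) ∣

numEvenOut : ∀ {n} → Digraph n → ℕ
numEvenOut D = ∣ tabulate (λ i → does (2 ∣? outdeg D i)) ∣

-- Inverting a set X of p vertices changes the out-degree of each vertex of X by p - 1 modulo 2
-- and leaves the other out-degrees unchanged. An acyclic tournament has out-degrees 0, 1, …, n - 1,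
-- of which ⌈n/2⌉ are even, so for odd p every (=p)-invertible tournament has ⌈n/2⌉ vertices of
-- even out-degree.
--
-- Conversely, choose a ranking R (a transitive tournament) whose out-degree parities agree with
-- those of T except at the vertex a of rank 0: when T has ⌈n/2⌉ vertices of even out-degree,
-- match parities to ranks directly; when p is even, first adjust parities with the two
-- inversions S ∪ {v}, S ∪ {a}. For |S| = p - 2 the four inversions S ∪ {u,v}, S ∪ {u,y},
-- S ∪ {x,v}, S ∪ {x,y} reverse exactly the four arcs between {u,x} and {v,y}. With such moves
-- through the vertices b and c of ranks 1 and 2, every arc can be aligned with R except those
-- at b and the arc ca; the parity conditions then force T to be R, or R with the triangle a b c
-- reversed, which is again transitive. Reversals are recorded as patterns over ℤ/2, so that
-- sequences of inversions compose by xor.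

module Submission where

open import Defs
open import Data.Bool using (Bool; true; false; if_then_else_; _∧_; _∨_; not; _xor_; T)
open import Data.Bool.Properties
  using (not-involutive; not-injective; xor-identityʳ; xor-same; xor-comm; xor-assoc; ∧-comm;
         ∧-distribˡ-xor; ∧-distribʳ-xor; not-distribˡ-xor; xor-annihilates-not; ∧-zeroʳ; ∧-identityʳ; ∨-zeroʳ)
open import Data.Bool.Solver using (module xor-∧-Solver)
open import Data.Nat using (ℕ; zero; suc; _≤_; _<_; _+_; _*_; z≤n; s≤s; _<ᵇ_; ⌈_/2⌉; ⌊_/2⌋)
import Data.Nat.Properties as ℕ
open import Data.Nat.Divisibility using (_∣_; _∣?_; divides)
open import Data.Fin using (Fin; zero; suc; toℕ; fromℕ<; punchIn; punchOut; inject₁; fromℕ)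
import Data.Fin as Fin
open import Data.Fin.Properties
  using (toℕ-fromℕ<; toℕ-injective; toℕ<n; punchIn-injective; punchInᵢ≢i; punchOut-injective;
         punchIn-punchOut)
  renaming (suc-injective to Fin-suc-injective)
open import Data.Fin.Subset using (Subset; ∣_∣)
open import Data.Vec using (lookup; tabulate)
open import Data.Vec.Properties using (lookup∘tabulate; tabulate∘lookup)
open import Data.List using (List; []; _∷_; _++_; length)
open import Data.List.Properties using (foldl-++)
open import Data.List.Relation.Unary.All using (All; []; _∷_)
open import Data.List.Relation.Unary.All.Properties using (++⁺)
open import Data.List.Membership.Propositional using (_∈_)
open import Data.List.Relation.Unary.Any using (here; there)
open import Data.Product using (Σ-syntax; _×_; _,_; proj₁; proj₂)
open import Data.Sum using (_⊎_; inj₁; inj₂)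
open import Data.Empty using (⊥-elim)
open import Function using (_∘_; case_of_)
open import Function.Bundles using (_⇔_; mk⇔)
open import Function.Definitions using (Injective)
open import Relation.Nullary using (¬_; does; yes; no)
open import Relation.Nullary.Decidable using (dec-true; dec-false)
open import Relation.Binary.PropositionalEquality

open xor-∧-Solver using (solve; _:+_; _:*_; _:=_; con)

private
  variable
    n m : ℕ

-- Booleans and sums over ℤ/2

infix 4 _≡ᵇ_

_≡ᵇ_ : Fin n → Fin n → Bool
i ≡ᵇ j = does (i Fin.≟ j)

≡ᵇ-refl : (i : Fin n) → (i ≡ᵇ i) ≡ true
≡ᵇ-refl i = dec-true (i Fin.≟ i) refl

≡ᵇ-≢ : {i j : Fin n} → i ≢ j → (i ≡ᵇ j) ≡ false
≡ᵇ-≢ {i = i} {j} = dec-false (i Fin.≟ j)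

≡ᵇ⇒≡ : {i j : Fin n} → (i ≡ᵇ j) ≡ true → i ≡ j
≡ᵇ⇒≡ {i = i} {j} h with i Fin.≟ j
... | yes i≡j = i≡j

∧-≡true : ∀ {x y} → x ∧ y ≡ true → x ≡ true × y ≡ true
∧-≡true {true} y≡true = refl , y≡true

not-≡ᵇ⇒≢ : {i j : Fin n} → not (i ≡ᵇ j) ≡ true → i ≢ j
not-≡ᵇ⇒≢ {i = i} h refl rewrite ≡ᵇ-refl i with () ← h

⨁ : (Fin n → Bool) → Bool
⨁ {zero}  f = false
⨁ {suc n} f = f zero xor ⨁ (f ∘ suc)

⨁-cong : {f g : Fin n → Bool} → (∀ i → f i ≡ g i) → ⨁ f ≡ ⨁ g
⨁-cong {zero}  f≗g = refl
⨁-cong {suc n} f≗g = cong₂ _xor_ (f≗g zero) (⨁-cong (f≗g ∘ suc))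

⨁-false : ⨁ {n} (λ _ → false) ≡ false
⨁-false {zero}  = refl
⨁-false {suc n} = ⨁-false {n}

⨁-xor : (f g : Fin n → Bool) → ⨁ (λ i → f i xor g i) ≡ ⨁ f xor ⨁ g
⨁-xor {zero}  f g = refl
⨁-xor {suc n} f g = begin
  (f zero xor g zero) xor ⨁ (λ i → f (suc i) xor g (suc i))
    ≡⟨ cong ((f zero xor g zero) xor_) (⨁-xor (f ∘ suc) (g ∘ suc)) ⟩
  (f zero xor g zero) xor (⨁ (f ∘ suc) xor ⨁ (g ∘ suc))
    ≡⟨ solve 4 (λ a b c d → (a :+ b) :+ (c :+ d) := (a :+ c) :+ (b :+ d)) refl
         (f zero) (g zero) (⨁ (f ∘ suc)) (⨁ (g ∘ suc)) ⟩
  (f zero xor ⨁ (f ∘ suc)) xor (g zero xor ⨁ (g ∘ suc)) ∎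
  where open ≡-Reasoning

⨁-∧ˡ : (b : Bool) (f : Fin n → Bool) → ⨁ (λ i → b ∧ f i) ≡ b ∧ ⨁ f
⨁-∧ˡ {zero}  b f = sym (∧-zeroʳ b)
⨁-∧ˡ {suc n} b f =
  trans (cong ((b ∧ f zero) xor_) (⨁-∧ˡ b (f ∘ suc))) (sym (∧-distribˡ-xor b (f zero) _))

⨁-δ : (w : Fin n) (f : Fin n → Bool) → ⨁ (λ j → (w ≡ᵇ j) ∧ f j) ≡ f w
⨁-δ {suc n} zero    f = trans (cong (f zero xor_) (⨁-false {n})) (xor-identityʳ (f zero))
⨁-δ {suc n} (suc w) f = ⨁-δ w (f ∘ suc)

⨁-pair : {x y : Fin n} (h : Fin n → Bool) → x ≢ y → (∀ j → j ≢ x → j ≢ y → h j ≡ false) →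
  ⨁ h ≡ h x xor h y
⨁-pair {x = x} {y} h x≢y off = begin
  ⨁ h                                               ≡⟨ ⨁-cong split ⟩
  ⨁ (λ j → ((x ≡ᵇ j) ∧ h j) xor ((y ≡ᵇ j) ∧ h j))
                                                    ≡⟨ ⨁-xor (λ j → (x ≡ᵇ j) ∧ h j) (λ j → (y ≡ᵇ j) ∧ h j) ⟩
  ⨁ (λ j → (x ≡ᵇ j) ∧ h j) xor ⨁ (λ j → (y ≡ᵇ j) ∧ h j)
                                                    ≡⟨ cong₂ _xor_ (⨁-δ x h) (⨁-δ y h) ⟩
  h x xor h y                                       ∎
  where
  open ≡-Reasoning
  split : ∀ j → h j ≡ ((x ≡ᵇ j) ∧ h j) xor ((y ≡ᵇ j) ∧ h j)
  split j with j Fin.≟ x | j Fin.≟ y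
  ... | yes refl | _        rewrite ≡ᵇ-refl j | ≡ᵇ-≢ (x≢y ∘ sym) = sym (xor-identityʳ (h j))
  ... | no _     | yes refl rewrite ≡ᵇ-refl j | ≡ᵇ-≢ x≢y = refl
  ... | no j≢x   | no j≢y   rewrite off j j≢x j≢y =
    sym (cong₂ _xor_ (∧-zeroʳ (x ≡ᵇ j)) (∧-zeroʳ (y ≡ᵇ j)))

⨁²-δ : (i j : Fin n) (f : Fin n → Fin n → Bool) →
  ⨁ (λ u → ⨁ λ v → (i ≡ᵇ u) ∧ ((j ≡ᵇ v) ∧ f u v)) ≡ f i j
⨁²-δ i j f = trans (⨁-cong inner) (⨁-δ i (λ u → f u j))
  where
  inner : ∀ u → ⨁ (λ v → (i ≡ᵇ u) ∧ ((j ≡ᵇ v) ∧ f u v)) ≡ (i ≡ᵇ u) ∧ f u j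
  inner u = trans (⨁-∧ˡ (i ≡ᵇ u) (λ v → (j ≡ᵇ v) ∧ f u v)) (cong ((i ≡ᵇ u) ∧_) (⨁-δ j (f u)))

⨁²-xor : (f g : Fin n → Fin n → Bool) →
  ⨁ (λ u → ⨁ λ v → f u v xor g u v) ≡ ⨁ (λ u → ⨁ λ v → f u v) xor ⨁ (λ u → ⨁ λ v → g u v)
⨁²-xor f g = trans (⨁-cong λ u → ⨁-xor (f u) (g u)) (⨁-xor (λ u → ⨁ (f u)) (λ u → ⨁ (g u)))

-- Counting

count : (Fin n → Bool) → ℕ
count {zero}  f = 0
count {suc n} f = if f zero then suc (count (f ∘ suc)) else count (f ∘ suc)

odd : ℕ → Bool
odd zero    = false
odd (suc m) = not (odd m)

count-cong : {f g : Fin n → Bool} → (∀ i → f i ≡ g i) → count f ≡ count g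
count-cong {zero}  f≗g = refl
count-cong {suc n} {f} {g} f≗g
  rewrite f≗g zero | count-cong {n} {f ∘ suc} {g ∘ suc} (f≗g ∘ suc) = refl

odd-count : (f : Fin n → Bool) → odd (count f) ≡ ⨁ f
odd-count {zero}  f = refl
odd-count {suc n} f with f zero
... | true  = cong not (odd-count (f ∘ suc))
... | false = odd-count (f ∘ suc)

∣tabulate∣≡count : (f : Fin n → Bool) → ∣ tabulate f ∣ ≡ count f
∣tabulate∣≡count {zero}  f = refl
∣tabulate∣≡count {suc n} f with f zero
... | true  = cong suc (∣tabulate∣≡count (f ∘ suc))
... | false = ∣tabulate∣≡count (f ∘ suc)

∣∣≡count : (X : Subset n) → ∣ X ∣ ≡ count (lookup X)
∣∣≡count X = trans (cong ∣_∣ (sym (tabulate∘lookup X))) (∣tabulate∣≡count (lookup X))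

count-≤ : (f : Fin n → Bool) → count f ≤ n
count-≤ {zero}  f = z≤n
count-≤ {suc n} f with f zero
... | true  = s≤s (count-≤ (f ∘ suc))
... | false = ℕ.m≤n⇒m≤1+n (count-≤ (f ∘ suc))

count-< : (f : Fin n → Bool) {i : Fin n} → f i ≡ false → count f < n
count-< {suc n} f {zero} fi rewrite fi = s≤s (count-≤ (f ∘ suc))
count-< {suc n} f {suc i} fi with f zero
... | true  = s≤s (count-< (f ∘ suc) fi)
... | false = ℕ.m<n⇒m<1+n (count-< (f ∘ suc) fi)

count-mono : (f g : Fin n → Bool) → (∀ i → f i ≡ true → g i ≡ true) → count f ≤ count g
count-mono {zero}  f g f⊆g = z≤n
count-mono {suc n} f g f⊆g with f zero | g zero | f⊆g zero
... | true  | true  | _ = s≤s (count-mono (f ∘ suc) (g ∘ suc) (f⊆g ∘ suc))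
... | true  | false | h with () ← h refl
... | false | true  | _ = ℕ.m≤n⇒m≤1+n (count-mono (f ∘ suc) (g ∘ suc) (f⊆g ∘ suc))
... | false | false | _ = count-mono (f ∘ suc) (g ∘ suc) (f⊆g ∘ suc)

count-strict : (f g : Fin n → Bool) → (∀ i → f i ≡ true → g i ≡ true) →
  {i : Fin n} → f i ≡ false → g i ≡ true → count f < count g
count-strict {suc n} f g f⊆g {zero} fi gi rewrite fi | gi =
  s≤s (count-mono (f ∘ suc) (g ∘ suc) (f⊆g ∘ suc))
count-strict {suc n} f g f⊆g {suc i} fi gi with f zero | g zero | f⊆g zero
... | true  | true  | _ = s≤s (count-strict (f ∘ suc) (g ∘ suc) (f⊆g ∘ suc) fi gi)
... | true  | false | h with () ← h refl
... | false | true  | _ = ℕ.m<n⇒m<1+n (count-strict (f ∘ suc) (g ∘ suc) (f⊆g ∘ suc) fi gi)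
... | false | false | _ = count-strict (f ∘ suc) (g ∘ suc) (f⊆g ∘ suc) fi gi

count+count-not : (f : Fin n → Bool) → count f + count (not ∘ f) ≡ n
count+count-not {zero}  f = refl
count+count-not {suc n} f with f zero
... | true  = cong suc (count+count-not (f ∘ suc))
... | false = trans (ℕ.+-suc _ _) (cong suc (count+count-not (f ∘ suc)))

count-witness : (f : Fin n → Bool) → 0 < count f → Σ[ i ∈ Fin n ] f i ≡ true
count-witness {suc n} f pos with f zero in f0
... | true  = zero , f0
... | false = let i , fi = count-witness (f ∘ suc) pos in suc i , fi

count-∨ : (f g : Fin n → Bool) → count (λ i → f i ∨ g i) ≤ count f + count g
count-∨ {zero}  f g = z≤n
count-∨ {suc n} f g with f zero | g zero | count-∨ (f ∘ suc) (g ∘ suc)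
... | true  | true  | r = s≤s (ℕ.≤-trans r (ℕ.≤-trans (ℕ.n≤1+n _) (ℕ.≤-reflexive (sym (ℕ.+-suc _ _)))))
... | true  | false | r = s≤s r
... | false | true  | r = ℕ.≤-trans (s≤s r) (ℕ.≤-reflexive (sym (ℕ.+-suc _ _)))
... | false | false | r = r

count-false : ∀ n → count {n} (λ _ → false) ≡ 0
count-false zero    = refl
count-false (suc n) = count-false n

count-δ : (w : Fin n) → count (λ j → j ≡ᵇ w) ≡ 1
count-δ {suc n} zero    = cong suc (count-false n)
count-δ {suc n} (suc w) = count-δ w

count-pos : (f : Fin n → Bool) {i : Fin n} → f i ≡ true → 0 < count f
count-pos f {i} fi =
  ℕ.<-≤-trans (s≤s z≤n) (ℕ.≤-trans (ℕ.≤-reflexive (sym (count-δ i))) (count-mono (_≡ᵇ i) f at-i))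
  where
  at-i : ∀ j → (j ≡ᵇ i) ≡ true → f j ≡ true
  at-i j j≡i = subst (λ k → f k ≡ true) (sym (≡ᵇ⇒≡ j≡i)) fi


toggle : (Fin n → Bool) → Fin n → Fin n → Bool
toggle f w i = f i xor (i ≡ᵇ w)
count-toggle : (f : Fin n → Bool) {w : Fin n} → f w ≡ false → count (toggle f w) ≡ suc (count f)
count-toggle {suc n} f {zero} f0 rewrite f0 =
  cong suc (count-cong λ i → xor-identityʳ (f (suc i)))
count-toggle {suc n} f {suc w} fw with f zero
... | true  = cong suc (count-toggle (f ∘ suc) fw)
... | false = count-toggle (f ∘ suc) fw

count-punchIn : (f : Fin (suc n) → Bool) (k : Fin (suc n)) →
  count f ≡ (if f k then suc (count (f ∘ punchIn k)) else count (f ∘ punchIn k))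
count-punchIn f zero = refl
count-punchIn {suc n} f (suc k) with f zero | f (suc k) | count-punchIn (f ∘ suc) k
... | true  | true  | e = cong suc e
... | true  | false | e = cong suc e
... | false | true  | e = e
... | false | false | e = e

count-∘-injective : (σ : Fin n → Fin n) → Injective _≡_ _≡_ σ → (f : Fin n → Bool) →
  count (f ∘ σ) ≡ count f
count-∘-injective {zero}  σ σ-inj f = refl
count-∘-injective {suc n} σ σ-inj f = trans split (sym (count-punchIn f k))
  where
  k = σ zero
  k≢σsuc : ∀ i → k ≢ σ (suc i)
  k≢σsuc i e with () ← σ-inj e
  σ′ : Fin n → Fin n
  σ′ i = punchOut (k≢σsuc i)
  σ′-inj : Injective _≡_ _≡_ σ′
  σ′-inj {i} {j} e = Fin-suc-injective (σ-inj (punchOut-injective (k≢σsuc i) (k≢σsuc j) e))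
  rest : count (f ∘ σ ∘ suc) ≡ count (f ∘ punchIn k)
  rest = trans (count-cong λ i → cong f (sym (punchIn-punchOut (k≢σsuc i))))
               (count-∘-injective σ′ σ′-inj (f ∘ punchIn k))
  split : count (f ∘ σ) ≡ (if f k then suc (count (f ∘ punchIn k)) else count (f ∘ punchIn k))
  split with f k
  ... | true  = cong suc rest
  ... | false = rest

injective⇒surjective : (σ : Fin n → Fin n) → Injective _≡_ _≡_ σ → ∀ m → Σ[ v ∈ Fin n ] σ v ≡ m
injective⇒surjective σ σ-inj m =
  let v , σv≡m = count-witness (λ v → σ v ≡ᵇ m) preimage in v , ≡ᵇ⇒≡ σv≡m
  where
  preimage : 0 < count (λ v → σ v ≡ᵇ m)
  preimage rewrite count-∘-injective σ σ-inj (_≡ᵇ m) | count-δ m = s≤s z≤n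

count-toℕ< : ∀ n k → k ≤ n → count {n} (λ i → toℕ i <ᵇ k) ≡ k
count-toℕ< n       zero    _         = count-false n
count-toℕ< (suc n) (suc k) (s≤s k≤n) = cong suc (count-toℕ< n k k≤n)

count-even-toℕ : ∀ n → count {n} (λ i → not (odd (toℕ i))) ≡ ⌈ n /2⌉
count-odd-toℕ  : ∀ n → count {n} (λ i → odd (toℕ i)) ≡ ⌊ n /2⌋
count-even-toℕ zero    = refl
count-even-toℕ (suc n) =
  cong suc (trans (count-cong {n} λ i → not-involutive (odd (toℕ i))) (count-odd-toℕ n))
count-odd-toℕ zero    = refl
count-odd-toℕ (suc n) = count-even-toℕ n

matching : (f g : Fin n → Bool) → count f ≡ count g →
  Σ[ σ ∈ (Fin n → Fin n) ] Injective _≡_ _≡_ σ × (∀ v → g (σ v) ≡ f v)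
matching {zero}  f g _ = (λ ()) , (λ {}) , λ ()
matching {suc n} f g f≈g = σ , σ-inj , σ-match
  where
  count-not : count (not ∘ f) ≡ count (not ∘ g)
  count-not = ℕ.+-cancelˡ-≡ (count f) _ _
    (trans (count+count-not f) (trans (sym (count+count-not g)) (cong (_+ count (not ∘ g)) (sym f≈g))))
  partner : ∀ b → f zero ≡ b → Σ[ k ∈ Fin (suc n) ] g k ≡ b
  partner true  f0 = count-witness g (subst (0 <_) f≈g (count-pos f f0))
  partner false f0 =
    let k , gk = count-witness (not ∘ g) (subst (0 <_) count-not (count-pos (not ∘ f) (cong not f0)))
    in k , not-injective gk
  k = proj₁ (partner (f zero) refl)
  gk = proj₂ (partner (f zero) refl)
  rest : count (f ∘ suc) ≡ count (g ∘ punchIn k)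
  rest = peel gk (trans f≈g (count-punchIn g k))
    where
    peel : ∀ {x y : Bool} {a b} → y ≡ x → (if x then suc a else a) ≡ (if y then suc b else b) → a ≡ b
    peel {true}  refl e = ℕ.suc-injective e
    peel {false} refl e = e
  σ′ = matching (f ∘ suc) (g ∘ punchIn k) rest
  σ : Fin (suc n) → Fin (suc n)
  σ zero    = k
  σ (suc i) = punchIn k (proj₁ σ′ i)
  σ-inj : Injective _≡_ _≡_ σ
  σ-inj {zero}  {zero}  _ = refl
  σ-inj {zero}  {suc j} e = ⊥-elim (punchInᵢ≢i k _ (sym e))
  σ-inj {suc i} {zero}  e = ⊥-elim (punchInᵢ≢i k _ e)
  σ-inj {suc i} {suc j} e = cong suc (proj₁ (proj₂ σ′) (punchIn-injective k _ _ e))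
  σ-match : ∀ v → g (σ v) ≡ f v
  σ-match zero    = gk
  σ-match (suc i) = proj₂ (proj₂ σ′) i

_∋ᵇ_ : List (Fin n) → Fin n → Bool
[]      ∋ᵇ i = false
(w ∷ L) ∋ᵇ i = (i ≡ᵇ w) ∨ (L ∋ᵇ i)

∈⇒∋ᵇ : {L : List (Fin n)} {w : Fin n} → w ∈ L → (L ∋ᵇ w) ≡ true
∈⇒∋ᵇ {w = w} (here refl) rewrite ≡ᵇ-refl w = refl
∈⇒∋ᵇ {L = v ∷ _} {w} (there w∈L) rewrite ∈⇒∋ᵇ w∈L = ∨-zeroʳ (w ≡ᵇ v)

count-∋ᵇ : (L : List (Fin n)) → count (L ∋ᵇ_) ≤ length L
count-∋ᵇ {n} []      = ℕ.≤-reflexive (count-false n)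
count-∋ᵇ (w ∷ L) = ℕ.≤-trans (count-∨ (_≡ᵇ w) (L ∋ᵇ_))
  (ℕ.+-mono-≤ (ℕ.≤-reflexive (count-δ w)) (count-∋ᵇ L))

subsetOutside : (F : Fin n → Bool) (k : ℕ) → k ≤ count (not ∘ F) →
  Σ[ s ∈ (Fin n → Bool) ] count s ≡ k × (∀ i → s i ≡ true → F i ≡ false)
subsetOutside {zero}  F zero    _ = (λ ()) , refl , λ ()
subsetOutside {suc n} F k       k≤ with F zero in F0
subsetOutside {suc n} F k       k≤ | true =
  let s , #s , s∩F = subsetOutside (F ∘ suc) k k≤ in
  (λ { zero → false ; (suc i) → s i }) , #s , λ { zero () ; (suc i) → s∩F i }
subsetOutside {suc n} F zero    _  | false = (λ _ → false) , count-false (suc n) , λ _ ()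
subsetOutside {suc n} F (suc k) (s≤s k≤) | false =
  let s , #s , s∩F = subsetOutside (F ∘ suc) k k≤ in
  (λ { zero → true ; (suc i) → s i }) , cong suc #s , λ { zero _ → F0 ; (suc i) → s∩F i }

subsetAvoiding : (L : List (Fin n)) (k : ℕ) → k + length L ≤ n →
  Σ[ s ∈ (Fin n → Bool) ] count s ≡ k × (∀ {w} → w ∈ L → s w ≡ false)
subsetAvoiding {n} L k room =
  let s , #s , s∩L = subsetOutside (L ∋ᵇ_) k room′ in s , #s , λ w∈L → avoid s∩L (∈⇒∋ᵇ w∈L)
  where
  room′ : k ≤ count (not ∘ (L ∋ᵇ_))
  room′ = ℕ.+-cancelʳ-≤ (count (L ∋ᵇ_)) k _ (begin
    k + count (L ∋ᵇ_)                         ≤⟨ ℕ.+-monoʳ-≤ k (count-∋ᵇ L) ⟩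
    k + length L                              ≤⟨ room ⟩
    n                                         ≡⟨ sym (count+count-not (L ∋ᵇ_)) ⟩
    count (L ∋ᵇ_) + count (not ∘ (L ∋ᵇ_))     ≡⟨ ℕ.+-comm (count (L ∋ᵇ_)) _ ⟩
    count (not ∘ (L ∋ᵇ_)) + count (L ∋ᵇ_)     ∎)
    where open ℕ.≤-Reasoning
  avoid : {s F : Fin n → Bool} → (∀ i → s i ≡ true → F i ≡ false) → ∀ {w} → F w ≡ true → s w ≡ false
  avoid {s} s∩F {w} Fw with s w in sw
  ... | true  with () ← trans (sym Fw) (s∩F w sw)
  ... | false = refl

odd-*2 : ∀ m → odd (m * 2) ≡ false
odd-*2 zero    = refl
odd-*2 (suc m) = trans (not-involutive (odd (m * 2))) (odd-*2 m)

even⇒2∣ : ∀ m → odd m ≡ false → 2 ∣ m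
even⇒2∣ zero          _ = divides 0 refl
even⇒2∣ (suc (suc m)) h with divides k m≡k*2 ← even⇒2∣ m (trans (sym (not-involutive (odd m))) h) =
  divides (suc k) (cong (2 +_) m≡k*2)

2∣⇒even : ∀ {m} → 2 ∣ m → odd m ≡ false
2∣⇒even (divides k m≡k*2) = trans (cong odd m≡k*2) (odd-*2 k)

2∤⇒odd : ∀ {m} → ¬ (2 ∣ m) → odd m ≡ true
2∤⇒odd {m} 2∤m with odd m in odd-m
... | true  = refl
... | false = ⊥-elim (2∤m (even⇒2∣ m odd-m))

does-2∣ : ∀ m → does (2 ∣? m) ≡ not (odd m)
does-2∣ m with odd m in odd-m
... | false = dec-true (2 ∣? m) (even⇒2∣ m odd-m)
... | true  = dec-false (2 ∣? m) λ 2∣m → case trans (sym odd-m) (2∣⇒even 2∣m) of λ ()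

-- Reversal patterns realized by (=p)-inversions

Pattern : ℕ → Set
Pattern n = Fin n → Fin n → Bool

flipBy : Pattern n → Digraph n → Digraph n
flipBy φ D i j = if φ i j then D j i else D i j

reversed : List (Subset n) → Pattern n
reversed []       i j = false
reversed (X ∷ Xs) i j = (lookup X i ∧ lookup X j) xor reversed Xs i j

memberParity : List (Subset n) → Fin n → Bool
memberParity []       w = false
memberParity (X ∷ Xs) w = lookup X w xor memberParity Xs w

Symmetric : Pattern n → Set
Symmetric φ = ∀ i j → φ i j ≡ φ j i

flipBy-flipBy : {φ ψ : Pattern n} → Symmetric ψ → (D : Digraph n) →
  ∀ i j → flipBy φ (flipBy ψ D) i j ≡ flipBy (λ i j → ψ i j xor φ i j) D i j
flipBy-flipBy {φ = φ} {ψ} ψ-sym D i j rewrite ψ-sym j i with φ i j | ψ i j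
... | true  | true  = refl
... | true  | false = refl
... | false | true  = refl
... | false | false = refl

invertAll-flipBy : (Xs : List (Subset n)) (D : Digraph n) →
  ∀ i j → invertAll Xs D i j ≡ flipBy (reversed Xs) D i j
invertAll-flipBy []       D i j = refl
invertAll-flipBy (X ∷ Xs) D i j =
  trans (invertAll-flipBy Xs (invert X D) i j)
        (flipBy-flipBy {φ = reversed Xs} (λ i j → ∧-comm (lookup X i) (lookup X j)) D i j)

flipBy-congˡ : {φ ψ : Pattern n} → (∀ i j → φ i j ≡ ψ i j) → (D : Digraph n) →
  ∀ i j → flipBy φ D i j ≡ flipBy ψ D i j
flipBy-congˡ φ≗ψ D i j rewrite φ≗ψ i j = refl

flipBy-congʳ : (φ : Pattern n) {D E : Digraph n} → (∀ i j → D i j ≡ E i j) →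
  ∀ i j → flipBy φ D i j ≡ flipBy φ E i j
flipBy-congʳ φ D≗E i j with φ i j
... | true  = D≗E j i
... | false = D≗E i j

flipBy-unflipped : (φ : Pattern n) (D : Digraph n) {i j : Fin n} → φ i j ≡ false → flipBy φ D i j ≡ D i j
flipBy-unflipped φ D {i} {j} φij rewrite φij = refl

reversed-++ : (Xs Ys : List (Subset n)) → ∀ i j → reversed (Xs ++ Ys) i j ≡ reversed Xs i j xor reversed Ys i j
reversed-++ []       Ys i j = refl
reversed-++ (X ∷ Xs) Ys i j rewrite reversed-++ Xs Ys i j = sym (xor-assoc (lookup X i ∧ lookup X j) _ _)

memberParity-++ : (Xs Ys : List (Subset n)) →
  ∀ w → memberParity (Xs ++ Ys) w ≡ memberParity Xs w xor memberParity Ys w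
memberParity-++ []       Ys w = refl
memberParity-++ (X ∷ Xs) Ys w rewrite memberParity-++ Xs Ys w = sym (xor-assoc (lookup X w) _ _)

-- A sequence of (=p)-inversions reversing exactly the arcs on the pairs of φ, in which the
-- vertices of μ lie in an odd number of the inverted sets.
record Realizes (p : ℕ) (φ : Pattern n) (μ : Fin n → Bool) : Set where
  field
    sets          : List (Subset n)
    sizes         : All (λ X → ∣ X ∣ ≡ p) sets
    reversed≗     : ∀ i j → reversed sets i j ≡ φ i j
    memberParity≗ : ∀ w → memberParity sets w ≡ μ w

  symmetric : Symmetric φ
  symmetric i j = trans (sym (reversed≗ i j)) (trans (reversed-sym sets) (reversed≗ j i))
    where
    reversed-sym : ∀ Xs → reversed Xs i j ≡ reversed Xs j i
    reversed-sym []       = refl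
    reversed-sym (X ∷ Xs) = cong₂ _xor_ (∧-comm (lookup X i) (lookup X j)) (reversed-sym Xs)

open Realizes

realizes-sets : {p : ℕ} (Xs : List (Subset n)) → All (λ X → ∣ X ∣ ≡ p) Xs →
  Realizes p (reversed Xs) (memberParity Xs)
realizes-sets Xs sizes = record
  { sets = Xs ; sizes = sizes ; reversed≗ = λ _ _ → refl ; memberParity≗ = λ _ → refl }

realizes-none : {p : ℕ} → Realizes {n} p (λ _ _ → false) (λ _ → false)
realizes-none = realizes-sets [] []

realizes-xor : {p : ℕ} {φ ψ : Pattern n} {μ ν : Fin n → Bool} → Realizes p φ μ → Realizes p ψ ν →
  Realizes p (λ i j → φ i j xor ψ i j) (λ w → μ w xor ν w)
realizes-xor r s = record
  { sets          = sets r ++ sets s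
  ; sizes         = ++⁺ (sizes r) (sizes s)
  ; reversed≗     = λ i j → trans (reversed-++ (sets r) (sets s) i j)
                                  (cong₂ _xor_ (reversed≗ r i j) (reversed≗ s i j))
  ; memberParity≗ = λ w → trans (memberParity-++ (sets r) (sets s) w)
                                (cong₂ _xor_ (memberParity≗ r w) (memberParity≗ s w))
  }

realizes-if : {p : ℕ} {φ : Pattern n} {μ : Fin n → Bool} (b : Bool) → Realizes p φ μ →
  Realizes p (λ i j → b ∧ φ i j) (λ w → b ∧ μ w)
realizes-if true  r = r
realizes-if false r = realizes-none

realizes-⨁ : {p : ℕ} {φ : Fin m → Pattern n} {μ : Fin m → Fin n → Bool} →
  (∀ k → Realizes p (φ k) (μ k)) → Realizes p (λ i j → ⨁ λ k → φ k i j) (λ w → ⨁ λ k → μ k w)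
realizes-⨁ {zero}  r = realizes-none
realizes-⨁ {suc m} r = realizes-xor (r zero) (realizes-⨁ (r ∘ suc))

realizes-μ-cong : {p : ℕ} {φ : Pattern n} {μ ν : Fin n → Bool} → (∀ w → μ w ≡ ν w) →
  Realizes p φ μ → Realizes p φ ν
realizes-μ-cong μ≗ν r = record
  { sets = sets r ; sizes = sizes r ; reversed≗ = reversed≗ r
  ; memberParity≗ = λ w → trans (memberParity≗ r w) (μ≗ν w) }

realizes-⨁-balanced : {p : ℕ} {φ : Fin m → Pattern n} → (∀ k → Realizes p (φ k) (λ _ → false)) →
  Realizes p (λ i j → ⨁ λ k → φ k i j) (λ _ → false)
realizes-⨁-balanced {m} r = realizes-μ-cong (λ _ → ⨁-false {m}) (realizes-⨁ r)

acyclic-cong : {D E : Digraph n} → (∀ i j → D i j ≡ E i j) → Acyclic E → Acyclic D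
acyclic-cong D≗E acyclic cycle = acyclic record
  { k = k ; c = c ; inj = inj
  ; step = λ i → trans (sym (D≗E _ _)) (step i) ; close = trans (sym (D≗E _ _)) close }
  where open Cycle cycle

acyclic⇒invertible : {p : ℕ} {D : Digraph n} → Acyclic D → Invertible= p D
acyclic⇒invertible acyclic = [] , [] , acyclic

invertible-flipBy : {p : ℕ} {φ : Pattern n} {μ : Fin n → Bool} {D : Digraph n} →
  Realizes p φ μ → Invertible= p (flipBy φ D) → Invertible= p D
invertible-flipBy {φ = φ} {D = D} r (Ys , sizesY , acyclic) =
  sets r ++ Ys , ++⁺ (sizes r) sizesY , acyclic-cong invertAll≗ acyclic
  where
  invertAll≗ : ∀ i j → invertAll (sets r ++ Ys) D i j ≡ invertAll Ys (flipBy φ D) i j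
  invertAll≗ i j = begin
    invertAll (sets r ++ Ys) D i j                   ≡⟨ cong (λ E → E i j) (foldl-++ _ D (sets r) Ys) ⟩
    invertAll Ys (invertAll (sets r) D) i j          ≡⟨ invertAll-flipBy Ys _ i j ⟩
    flipBy (reversed Ys) (invertAll (sets r) D) i j  ≡⟨ flipBy-congʳ (reversed Ys) prefix i j ⟩
    flipBy (reversed Ys) (flipBy φ D) i j            ≡⟨ invertAll-flipBy Ys _ i j ⟨
    invertAll Ys (flipBy φ D) i j                    ∎
    where
    open ≡-Reasoning
    prefix : ∀ i j → invertAll (sets r) D i j ≡ flipBy φ D i j
    prefix i j = trans (invertAll-flipBy (sets r) D i j) (flipBy-congˡ (reversed≗ r) D i j)

-- Tournaments and out-degree parities

record IsTournamentᵇ (D : Digraph n) : Set where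
  field
    loopless : ∀ i → D i i ≡ false
    converse : ∀ i j → i ≢ j → D j i ≡ not (D i j)

open IsTournamentᵇ

isTournament⇒isTournamentᵇ : {D : Digraph n} → IsTournament D → IsTournamentᵇ D
isTournament⇒isTournamentᵇ {D = D} ((loopless , antisym) , total) = record
  { loopless = loopless ; converse = converse′ }
  where
  converse′ : ∀ i j → i ≢ j → D j i ≡ not (D i j)
  converse′ i j i≢j with D i j in ij | D j i in ji
  ... | true  | true  with () ← trans (sym ji) (antisym i j ij)
  ... | true  | false = refl
  ... | false | true  = refl
  ... | false | false with total i j i≢j
  ...   | inj₁ ij′ with () ← trans (sym ij′) ij
  ...   | inj₂ ji′ with () ← trans (sym ji′) ji

flipBy-≢ : {D : Digraph n} → IsTournamentᵇ D → (φ : Pattern n) →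
  ∀ {i j} → i ≢ j → flipBy φ D i j ≡ D i j xor φ i j
flipBy-≢ {D = D} t φ {i} {j} i≢j with φ i j
... | true  = trans (converse t i j i≢j) (sym (xor-comm (D i j) true))
... | false = sym (xor-identityʳ (D i j))

flipBy-isTournamentᵇ : {φ : Pattern n} {D : Digraph n} → Symmetric φ → IsTournamentᵇ D →
  IsTournamentᵇ (flipBy φ D)
flipBy-isTournamentᵇ {φ = φ} {D} φ-sym t = record { loopless = loopless′ ; converse = converse′ }
  where
  loopless′ : ∀ i → flipBy φ D i i ≡ false
  loopless′ i with φ i i
  ... | true  = loopless t i
  ... | false = loopless t i
  converse′ : ∀ i j → i ≢ j → flipBy φ D j i ≡ not (flipBy φ D i j)
  converse′ i j i≢j = begin
    flipBy φ D j i            ≡⟨ flipBy-≢ t φ (i≢j ∘ sym) ⟩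
    D j i xor φ j i           ≡⟨ cong₂ _xor_ (converse t i j i≢j) (φ-sym j i) ⟩
    not (D i j) xor φ i j     ≡⟨ not-distribˡ-xor (D i j) (φ i j) ⟨
    not (D i j xor φ i j)     ≡⟨ cong not (flipBy-≢ t φ i≢j) ⟨
    not (flipBy φ D i j)      ∎
    where open ≡-Reasoning

odd-outdeg : (D : Digraph n) (w : Fin n) → odd (outdeg D w) ≡ ⨁ (D w)
odd-outdeg D w = trans (cong odd (∣tabulate∣≡count (D w))) (odd-count (D w))

numEvenOut≡count : (D : Digraph n) → numEvenOut D ≡ count (λ i → not (⨁ (D i)))
numEvenOut≡count D = trans (∣tabulate∣≡count (λ i → does (2 ∣? outdeg D i)))
  (count-cong λ i → trans (does-2∣ (outdeg D i)) (cong not (odd-outdeg D i)))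

degreeParity : Pattern n → Fin n → Bool
degreeParity φ w = ⨁ λ j → not (w ≡ᵇ j) ∧ φ w j

⨁-flipBy : {D : Digraph n} → IsTournamentᵇ D → (φ : Pattern n) →
  ∀ w → ⨁ (flipBy φ D w) ≡ ⨁ (D w) xor degreeParity φ w
⨁-flipBy {D = D} t φ w = trans (⨁-cong pointwise) (⨁-xor (D w) _)
  where
  pointwise : ∀ j → flipBy φ D w j ≡ D w j xor (not (w ≡ᵇ j) ∧ φ w j)
  pointwise j with w Fin.≟ j
  ... | yes refl with φ w w
  ...   | true  = sym (xor-identityʳ (D w w))
  ...   | false = sym (xor-identityʳ (D w w))
  pointwise j | no w≢j = flipBy-≢ t φ w≢j

-- A vertex of a p-set lies in p - 1 of its pairs.
degreeParity-reversed : {p : ℕ} (Xs : List (Subset n)) → All (λ X → ∣ X ∣ ≡ p) Xs →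
  ∀ w → degreeParity (reversed Xs) w ≡ memberParity Xs w ∧ not (odd p)
degreeParity-reversed {n} []  []  w = trans (⨁-cong λ j → ∧-zeroʳ (not (w ≡ᵇ j))) (⨁-false {n})
degreeParity-reversed {p = p} (X ∷ Xs) (∣X∣≡p ∷ sizes) w = begin
  ⨁ (λ j → not (w ≡ᵇ j) ∧ ((lookup X w ∧ lookup X j) xor reversed Xs w j))
    ≡⟨ ⨁-cong (λ j → ∧-distribˡ-xor (not (w ≡ᵇ j)) _ _) ⟩
  ⨁ (λ j → (not (w ≡ᵇ j) ∧ (lookup X w ∧ lookup X j)) xor (not (w ≡ᵇ j) ∧ reversed Xs w j))
    ≡⟨ ⨁-xor (λ j → not (w ≡ᵇ j) ∧ (lookup X w ∧ lookup X j))
             (λ j → not (w ≡ᵇ j) ∧ reversed Xs w j) ⟩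
  degreeParity (λ i j → lookup X i ∧ lookup X j) w xor degreeParity (reversed Xs) w
    ≡⟨ cong₂ _xor_ single (degreeParity-reversed Xs sizes w) ⟩
  (lookup X w ∧ not (odd p)) xor (memberParity Xs w ∧ not (odd p))
    ≡⟨ ∧-distribʳ-xor (not (odd p)) (lookup X w) _ ⟨
  memberParity (X ∷ Xs) w ∧ not (odd p) ∎
  where
  open ≡-Reasoning
  split : ∀ a b c → not a ∧ (b ∧ c) ≡ b ∧ (c xor (a ∧ c))
  split true  true  true  = refl
  split true  true  false = refl
  split true  false c     = refl
  split false b     c     = cong (b ∧_) (sym (xor-identityʳ c))
  absorb : ∀ b o → b ∧ (o xor b) ≡ b ∧ not o
  absorb true  o = xor-comm o true
  absorb false o = refl
  single : degreeParity (λ i j → lookup X i ∧ lookup X j) w ≡ lookup X w ∧ not (odd p)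
  single = begin
    ⨁ (λ j → not (w ≡ᵇ j) ∧ (lookup X w ∧ lookup X j))
      ≡⟨ ⨁-cong (λ j → split (w ≡ᵇ j) (lookup X w) (lookup X j)) ⟩
    ⨁ (λ j → lookup X w ∧ (lookup X j xor ((w ≡ᵇ j) ∧ lookup X j)))
      ≡⟨ ⨁-∧ˡ (lookup X w) (λ j → lookup X j xor ((w ≡ᵇ j) ∧ lookup X j)) ⟩
    lookup X w ∧ ⨁ (λ j → lookup X j xor ((w ≡ᵇ j) ∧ lookup X j))
      ≡⟨ cong (lookup X w ∧_) (trans (⨁-xor (lookup X) _) (cong (⨁ (lookup X) xor_) (⨁-δ w (lookup X)))) ⟩
    lookup X w ∧ (⨁ (lookup X) xor lookup X w)
      ≡⟨ cong (λ o → lookup X w ∧ (o xor lookup X w))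
              (trans (sym (odd-count (lookup X))) (cong odd (trans (sym (∣∣≡count X)) ∣X∣≡p))) ⟩
    lookup X w ∧ (odd p xor lookup X w)
      ≡⟨ absorb (lookup X w) (odd p) ⟩
    lookup X w ∧ not (odd p) ∎

⨁-flipBy-realized : {p : ℕ} {φ : Pattern n} {μ : Fin n → Bool} {D : Digraph n} →
  IsTournamentᵇ D → Realizes p φ μ → ∀ w → ⨁ (flipBy φ D w) ≡ ⨁ (D w) xor (μ w ∧ not (odd p))
⨁-flipBy-realized {p = p} {φ} {μ} {D} t r w = begin
  ⨁ (flipBy φ D w)
    ≡⟨ ⨁-flipBy t φ w ⟩
  ⨁ (D w) xor degreeParity φ w
    ≡⟨ cong (⨁ (D w) xor_) (⨁-cong λ j → cong (not (w ≡ᵇ j) ∧_) (reversed≗ r w j)) ⟨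
  ⨁ (D w) xor degreeParity (reversed (sets r)) w
    ≡⟨ cong (⨁ (D w) xor_) (degreeParity-reversed (sets r) (sizes r) w) ⟩
  ⨁ (D w) xor (memberParity (sets r) w ∧ not (odd p))
    ≡⟨ cong (λ b → ⨁ (D w) xor (b ∧ not (odd p))) (memberParity≗ r w) ⟩
  ⨁ (D w) xor (μ w ∧ not (odd p)) ∎
  where open ≡-Reasoning

⨁-flipBy-balanced : {p : ℕ} {φ : Pattern n} {D : Digraph n} →
  IsTournamentᵇ D → Realizes p φ (λ _ → false) → ∀ w → ⨁ (flipBy φ D w) ≡ ⨁ (D w)
⨁-flipBy-balanced {D = D} t r w = trans (⨁-flipBy-realized t r w) (xor-identityʳ (⨁ (D w)))

reverse-misaligned : {D R : Digraph n} → IsTournamentᵇ D → IsTournamentᵇ R → ∀ {i j} → i ≢ j →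
  D i j xor ((D i j ∧ R j i) xor (D j i ∧ R i j)) ≡ R i j
reverse-misaligned {D = D} {R} D-t R-t {i} {j} i≢j rewrite converse D-t i j i≢j | converse R-t i j i≢j
  with D i j | R i j
... | true  | true  = refl
... | true  | false = refl
... | false | true  = refl
... | false | false = refl

-- The K₂₂ and pair patterns

-- The indicator of {u, x} only when u ≢ x.
oneOf : Fin n → Fin n → Fin n → Bool
oneOf u x i = (i ≡ᵇ u) xor (i ≡ᵇ x)

K₂₂ : Fin n → Fin n → Fin n → Fin n → Pattern n
K₂₂ u x v y i j = (oneOf u x i ∧ oneOf v y j) xor (oneOf v y i ∧ oneOf u x j)

record Distinct₄ (u x v y : Fin n) : Set where
  field
    u≢x : u ≢ x
    u≢v : u ≢ v
    u≢y : u ≢ y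
    x≢v : x ≢ v
    x≢y : x ≢ y
    v≢y : v ≢ y

-- Invert S ∪ {u,v}, S ∪ {u,y}, S ∪ {x,v} and S ∪ {x,y} for a (p-2)-set S avoiding u, x, v, y:
-- a pair other than the four between {u, x} and {v, y} lies in none, two or all four of them.
realizes-K₂₂ : (q : ℕ) → q + 4 ≤ n → {u x v y : Fin n} → Distinct₄ u x v y →
  Realizes (2 + q) (K₂₂ u x v y) (λ _ → false)
realizes-K₂₂ {n} q room {u} {x} {v} {y} distinct = record
  { sets          = Xs
  ; sizes         = size u≢v (s∉ u∈) (s∉ v∈) ∷ size u≢y (s∉ u∈) (s∉ y∈)
                  ∷ size x≢v (s∉ x∈) (s∉ v∈) ∷ size x≢y (s∉ x∈) (s∉ y∈) ∷ []
  ; reversed≗     = reversed≗′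
  ; memberParity≗ = memberParity≗′
  }
  where
  open Distinct₄ distinct
  S = subsetAvoiding (u ∷ x ∷ v ∷ y ∷ []) q room
  s : Fin n → Bool
  s = proj₁ S
  s∉ : ∀ {w} → w ∈ u ∷ x ∷ v ∷ y ∷ [] → s w ≡ false
  s∉ = proj₂ (proj₂ S)
  u∈ = here refl
  x∈ = there (here refl)
  v∈ = there (there (here refl))
  y∈ = there (there (there (here refl)))
  X : Fin n → Fin n → Subset n
  X P Q = tabulate (toggle (toggle s P) Q)
  Xs = X u v ∷ X u y ∷ X x v ∷ X x y ∷ []
  size : ∀ {P Q} → P ≢ Q → s P ≡ false → s Q ≡ false → ∣ X P Q ∣ ≡ 2 + q
  size {P} {Q} P≢Q sP sQ = begin
    ∣ X P Q ∣                        ≡⟨ ∣tabulate∣≡count (toggle (toggle s P) Q) ⟩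
    count (toggle (toggle s P) Q)    ≡⟨ count-toggle (toggle s P) s′Q ⟩
    suc (count (toggle s P))         ≡⟨ cong suc (count-toggle s sP) ⟩
    suc (suc (count s))              ≡⟨ cong (2 +_) (proj₁ (proj₂ S)) ⟩
    2 + q                            ∎
    where
    open ≡-Reasoning
    s′Q : toggle s P Q ≡ false
    s′Q = trans (cong (_xor (Q ≡ᵇ P)) sQ) (≡ᵇ-≢ (P≢Q ∘ sym))
  X≡ : ∀ P Q i → lookup (X P Q) i ≡ (s i xor (i ≡ᵇ P)) xor (i ≡ᵇ Q)
  X≡ P Q = lookup∘tabulate (toggle (toggle s P) Q)
  reversed≗′ : ∀ i j → reversed Xs i j ≡ K₂₂ u x v y i j
  reversed≗′ i j
    rewrite X≡ u v i | X≡ u v j | X≡ u y i | X≡ u y j | X≡ x v i | X≡ x v j | X≡ x y i | X≡ x y j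
    = solve 10 (λ sᵢ sⱼ iu ix iv iy ju jx jv jy →
        (((sᵢ :+ iu) :+ iv) :* ((sⱼ :+ ju) :+ jv)) :+ ((((sᵢ :+ iu) :+ iy) :* ((sⱼ :+ ju) :+ jy))
          :+ ((((sᵢ :+ ix) :+ iv) :* ((sⱼ :+ jx) :+ jv)) :+ ((((sᵢ :+ ix) :+ iy) :* ((sⱼ :+ jx) :+ jy)) :+ con false)))
        := ((iu :+ ix) :* (jv :+ jy)) :+ ((iv :+ iy) :* (ju :+ jx))) refl
        (s i) (s j) (i ≡ᵇ u) (i ≡ᵇ x) (i ≡ᵇ v) (i ≡ᵇ y) (j ≡ᵇ u) (j ≡ᵇ x) (j ≡ᵇ v) (j ≡ᵇ y)
  memberParity≗′ : ∀ w → memberParity Xs w ≡ false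
  memberParity≗′ w rewrite X≡ u v w | X≡ u y w | X≡ x v w | X≡ x y w
    = solve 5 (λ s′ wu wx wv wy →
        ((s′ :+ wu) :+ wv) :+ (((s′ :+ wu) :+ wy) :+ (((s′ :+ wx) :+ wv) :+ (((s′ :+ wx) :+ wy) :+ con false)))
        := con false) refl (s w) (w ≡ᵇ u) (w ≡ᵇ x) (w ≡ᵇ v) (w ≡ᵇ y)

realizes-K₂₂-if : (q : ℕ) → q + 4 ≤ n → {u x v y : Fin n} (β : Bool) → (β ≡ true → Distinct₄ u x v y) →
  Realizes (2 + q) (λ i j → β ∧ K₂₂ u x v y i j) (λ _ → false)
realizes-K₂₂-if q room true  distinct = realizes-K₂₂ q room (distinct refl)
realizes-K₂₂-if q room false _        = realizes-none

-- Invert S ∪ {v} and S ∪ {a} for a (p-1)-set S avoiding v and a (nothing if v = a).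
realizes-pair : (k : ℕ) → k + 2 ≤ n → (v a : Fin n) →
  Σ[ φ ∈ Pattern n ] Realizes (suc k) φ (λ w → (w ≡ᵇ v) xor (w ≡ᵇ a))
realizes-pair {n} k room v a with v Fin.≟ a
... | yes refl = (λ _ _ → false) , realizes-μ-cong (λ w → sym (xor-same (w ≡ᵇ v))) realizes-none
... | no v≢a = reversed Xs ,
  realizes-μ-cong toggles-v-a (realizes-sets Xs (size (s∉ (here refl)) ∷ size (s∉ (there (here refl))) ∷ []))
  where
  S = subsetAvoiding (v ∷ a ∷ []) k room
  s : Fin n → Bool
  s = proj₁ S
  s∉ : ∀ {w} → w ∈ v ∷ a ∷ [] → s w ≡ false
  s∉ = proj₂ (proj₂ S)
  Xs = tabulate (toggle s v) ∷ tabulate (toggle s a) ∷ []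
  size : ∀ {P} → s P ≡ false → ∣ tabulate (toggle s P) ∣ ≡ suc k
  size {P} sP = trans (∣tabulate∣≡count (toggle s P)) (trans (count-toggle s sP) (cong suc (proj₁ (proj₂ S))))
  toggles-v-a : ∀ w → memberParity Xs w ≡ (w ≡ᵇ v) xor (w ≡ᵇ a)
  toggles-v-a w rewrite lookup∘tabulate (toggle s v) w | lookup∘tabulate (toggle s a) w
    = solve 3 (λ s′ wv wa → (s′ :+ wv) :+ ((s′ :+ wa) :+ con false) := wv :+ wa) refl (s w) (w ≡ᵇ v) (w ≡ᵇ a)

⨁²-K₂₂ : {x y i j : Fin n} (κ : Fin n → Fin n → Bool) → i ≢ x → i ≢ y → j ≢ x → j ≢ y →
  ⨁ (λ u → ⨁ λ v → κ u v ∧ K₂₂ u x v y i j) ≡ κ i j xor κ j i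
⨁²-K₂₂ {x = x} {y} {i} {j} κ i≢x i≢y j≢x j≢y
  rewrite ≡ᵇ-≢ i≢x | ≡ᵇ-≢ i≢y | ≡ᵇ-≢ j≢x | ≡ᵇ-≢ j≢y = begin
  ⨁ (λ u → ⨁ λ v → κ u v ∧ (((i ≡ᵇ u) xor false) ∧ ((j ≡ᵇ v) xor false)
                           xor ((i ≡ᵇ v) xor false) ∧ ((j ≡ᵇ u) xor false)))
    ≡⟨ ⨁-cong (λ u → ⨁-cong λ v → split (κ u v) (i ≡ᵇ u) (j ≡ᵇ v) (i ≡ᵇ v) (j ≡ᵇ u)) ⟩
  ⨁ (λ u → ⨁ λ v → ((i ≡ᵇ u) ∧ ((j ≡ᵇ v) ∧ κ u v)) xor ((j ≡ᵇ u) ∧ ((i ≡ᵇ v) ∧ κ u v)))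
    ≡⟨ ⨁²-xor (λ u v → (i ≡ᵇ u) ∧ ((j ≡ᵇ v) ∧ κ u v))
              (λ u v → (j ≡ᵇ u) ∧ ((i ≡ᵇ v) ∧ κ u v)) ⟩
  ⨁ (λ u → ⨁ λ v → (i ≡ᵇ u) ∧ ((j ≡ᵇ v) ∧ κ u v))
    xor ⨁ (λ u → ⨁ λ v → (j ≡ᵇ u) ∧ ((i ≡ᵇ v) ∧ κ u v))
    ≡⟨ cong₂ _xor_ (⨁²-δ i j κ) (⨁²-δ j i κ) ⟩
  κ i j xor κ j i ∎
  where
  open ≡-Reasoning
  split : ∀ k iu jv iv ju → k ∧ (((iu xor false) ∧ (jv xor false)) xor ((iv xor false) ∧ (ju xor false)))
                            ≡ (iu ∧ (jv ∧ k)) xor (ju ∧ (iv ∧ k))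
  split = solve 5 (λ k iu jv iv ju →
    k :* (((iu :+ con false) :* (jv :+ con false)) :+ ((iv :+ con false) :* (ju :+ con false)))
    := (iu :* (jv :* k)) :+ (ju :* (iv :* k))) refl

K₂₂-outside : {u x v y i j : Fin n} → i ≢ u → i ≢ x → j ≢ u → j ≢ x → K₂₂ u x v y i j ≡ false
K₂₂-outside {u = u} {x} {v} {y} {i} {j} i≢u i≢x j≢u j≢x
  rewrite ≡ᵇ-≢ i≢u | ≡ᵇ-≢ i≢x | ≡ᵇ-≢ j≢u | ≡ᵇ-≢ j≢x = ∧-zeroʳ ((i ≡ᵇ v) xor (i ≡ᵇ y))

K₂₂-row : {u x v y j : Fin n} → u ≢ x → j ≢ u → j ≢ x → j ≢ y → K₂₂ u x v y u j ≡ (j ≡ᵇ v)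
K₂₂-row {u = u} {x} {v} {y} {j} u≢x j≢u j≢x j≢y
  rewrite ≡ᵇ-refl u | ≡ᵇ-≢ u≢x | ≡ᵇ-≢ j≢u | ≡ᵇ-≢ j≢x | ≡ᵇ-≢ j≢y
        | ∧-zeroʳ ((u ≡ᵇ v) xor (u ≡ᵇ y)) = trans (xor-identityʳ _) (xor-identityʳ (j ≡ᵇ v))

-- Rankings

ranked : (Fin n → ℕ) → Digraph n
ranked ρ i j = ρ j <ᵇ ρ i

<ᵇ-irrefl : ∀ m → (m <ᵇ m) ≡ false
<ᵇ-irrefl zero    = refl
<ᵇ-irrefl (suc m) = <ᵇ-irrefl m

<ᵇ-false : ∀ {m k} → k ≤ m → (m <ᵇ k) ≡ false
<ᵇ-false {m}     {zero}  _         = refl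
<ᵇ-false {suc m} {suc k} (s≤s k≤m) = <ᵇ-false k≤m

<ᵇ-converse : ∀ m k → m ≢ k → (k <ᵇ m) ≡ not (m <ᵇ k)
<ᵇ-converse zero    zero    m≢k with () ← m≢k refl
<ᵇ-converse zero    (suc k) _   = refl
<ᵇ-converse (suc m) zero    _   = refl
<ᵇ-converse (suc m) (suc k) m≢k = <ᵇ-converse m k (m≢k ∘ cong suc)

ranked-isTournamentᵇ : {ρ : Fin n → ℕ} → Injective _≡_ _≡_ ρ → IsTournamentᵇ (ranked ρ)
ranked-isTournamentᵇ {ρ = ρ} ρ-inj = record
  { loopless = λ i → <ᵇ-irrefl (ρ i)
  ; converse = λ i j i≢j → <ᵇ-converse (ρ j) (ρ i) (i≢j ∘ ρ-inj ∘ sym) }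

acyclic-by-rank : {D : Digraph n} (ρ : Fin n → ℕ) → (∀ i j → D i j ≡ true → ρ j < ρ i) → Acyclic D
acyclic-by-rank {D = D} ρ descends cycle =
  ℕ.<-irrefl refl (ℕ.<-trans (descends _ _ close) (along (ρ ∘ c) (λ i → descends _ _ (step i))))
  where
  open Cycle cycle
  along : ∀ {k} (f : Fin (suc (suc k)) → ℕ) → (∀ (i : Fin (suc k)) → f (suc i) < f (inject₁ i)) →
    f (fromℕ (suc k)) < f zero
  along {zero}  f f↓ = f↓ zero
  along {suc k} f f↓ = ℕ.<-trans (f↓ (fromℕ (suc k))) (along (f ∘ inject₁) (f↓ ∘ inject₁))

not-<ᵇ⇒≥ : ∀ m k → not (m <ᵇ k) ≡ true → k ≤ m
not-<ᵇ⇒≥ m       zero    _ = z≤n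
not-<ᵇ⇒≥ (suc m) (suc k) h = s≤s (not-<ᵇ⇒≥ m k h)

⨁-ranked-toℕ : (σ : Fin n → Fin n) → Injective _≡_ _≡_ σ →
  ∀ v → ⨁ (ranked (toℕ ∘ σ) v) ≡ odd (toℕ (σ v))
⨁-ranked-toℕ {n} σ σ-inj v = begin
  ⨁ (ranked (toℕ ∘ σ) v)
    ≡⟨ odd-count (ranked (toℕ ∘ σ) v) ⟨
  odd (count (λ j → toℕ (σ j) <ᵇ toℕ (σ v)))
    ≡⟨ cong odd (count-∘-injective σ σ-inj (λ m → toℕ m <ᵇ toℕ (σ v))) ⟩
  odd (count {n} (λ m → toℕ m <ᵇ toℕ (σ v)))
    ≡⟨ cong odd (count-toℕ< n (toℕ (σ v)) (ℕ.<⇒≤ (toℕ<n (σ v)))) ⟩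
  odd (toℕ (σ v)) ∎
  where open ≡-Reasoning

reverse₃ : ℕ → ℕ
reverse₃ 0 = 2
reverse₃ 1 = 1
reverse₃ 2 = 0
reverse₃ m@(suc (suc (suc _))) = m

reverse₃-<ᵇ : ∀ m k → m ≢ k → (reverse₃ k <ᵇ reverse₃ m) ≡ (k <ᵇ m) xor ((m <ᵇ 3) ∧ (k <ᵇ 3))
reverse₃-<ᵇ 0 0 m≢k with () ← m≢k refl
reverse₃-<ᵇ 1 1 m≢k with () ← m≢k refl
reverse₃-<ᵇ 2 2 m≢k with () ← m≢k refl
reverse₃-<ᵇ 0 1 _ = refl
reverse₃-<ᵇ 0 2 _ = refl
reverse₃-<ᵇ 1 0 _ = refl
reverse₃-<ᵇ 1 2 _ = refl
reverse₃-<ᵇ 2 0 _ = refl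
reverse₃-<ᵇ 2 1 _ = refl
reverse₃-<ᵇ 0 (suc (suc (suc k))) _ = refl
reverse₃-<ᵇ 1 (suc (suc (suc k))) _ = refl
reverse₃-<ᵇ 2 (suc (suc (suc k))) _ = refl
reverse₃-<ᵇ (suc (suc (suc m))) 0 _ = refl
reverse₃-<ᵇ (suc (suc (suc m))) 1 _ = refl
reverse₃-<ᵇ (suc (suc (suc m))) 2 _ = refl
reverse₃-<ᵇ (suc (suc (suc m))) (suc (suc (suc k))) _ = sym (xor-identityʳ _)

reverse₃-if : Bool → ℕ → ℕ
reverse₃-if t m = if t then reverse₃ m else m

reverse₃-if-<ᵇ : ∀ t m k → m ≢ k →
  (reverse₃-if t k <ᵇ reverse₃-if t m) ≡ (k <ᵇ m) xor (t ∧ ((m <ᵇ 3) ∧ (k <ᵇ 3)))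
reverse₃-if-<ᵇ true  m k m≢k = reverse₃-<ᵇ m k m≢k
reverse₃-if-<ᵇ false m k _   = sym (xor-identityʳ (k <ᵇ m))

-- Acyclic tournaments

cycle₃ : {D : Digraph n} {i j k : Fin n} → D i j ≡ true → D j k ≡ true → D k i ≡ true →
  i ≢ j → j ≢ k → k ≢ i → Cycle D
cycle₃ {D = D} {i} {j} {k} ij jk ki i≢j j≢k k≢i = record
  { k = 1 ; c = c ; inj = c-inj ; step = λ { zero → ij ; (suc zero) → jk } ; close = ki }
  where
  c : Fin 3 → Fin _
  c zero             = i
  c (suc zero)       = j
  c (suc (suc zero)) = k
  c-inj : Injective _≡_ _≡_ c
  c-inj {zero}             {zero}             _ = refl
  c-inj {zero}             {suc zero}         e = ⊥-elim (i≢j e)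
  c-inj {zero}             {suc (suc zero)}   e = ⊥-elim (k≢i (sym e))
  c-inj {suc zero}         {zero}             e = ⊥-elim (i≢j (sym e))
  c-inj {suc zero}         {suc zero}         _ = refl
  c-inj {suc zero}         {suc (suc zero)}   e = ⊥-elim (j≢k e)
  c-inj {suc (suc zero)}   {zero}             e = ⊥-elim (k≢i e)
  c-inj {suc (suc zero)}   {suc zero}         e = ⊥-elim (j≢k (sym e))
  c-inj {suc (suc zero)}   {suc (suc zero)}   _ = refl

arc⇒≢ : {D : Digraph n} → IsTournamentᵇ D → ∀ {i j} → D i j ≡ true → i ≢ j
arc⇒≢ D-t {i} ij refl with () ← trans (sym ij) (loopless D-t i)

-- Every out-neighbour k of j is an out-neighbour of i, for otherwise i → j → k → i is a cycle.
acyclic⇒outdeg-decreasing : {A : Digraph n} → IsTournamentᵇ A → Acyclic A →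
  ∀ {i j} → A i j ≡ true → count (A j) < count (A i)
acyclic⇒outdeg-decreasing {A = A} A-t acyclic {i} {j} ij =
  count-strict (A j) (A i) transitive (loopless A-t j) ij
  where
  transitive : ∀ k → A j k ≡ true → A i k ≡ true
  transitive k jk with A i k in ik
  ... | true  = refl
  ... | false = ⊥-elim (acyclic (cycle₃ ij jk ki (arc⇒≢ A-t ij) (arc⇒≢ A-t jk) k≢i))
    where
    k≢i : k ≢ i
    k≢i refl with () ← trans (sym jk) (trans (converse A-t _ _ (arc⇒≢ A-t ij)) (cong not ij))
    ki : A k i ≡ true
    ki = trans (converse A-t i k (k≢i ∘ sym)) (cong not ik)

acyclic⇒outdeg-injective : {A : Digraph n} → IsTournamentᵇ A → Acyclic A →
  ∀ i j → count (A i) ≡ count (A j) → i ≡ j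
acyclic⇒outdeg-injective {A = A} A-t acyclic i j same with i Fin.≟ j
... | yes i≡j = i≡j
... | no i≢j with A i j in ij
...   | true  = ⊥-elim (ℕ.<-irrefl (sym same) (acyclic⇒outdeg-decreasing A-t acyclic ij))
...   | false = ⊥-elim (ℕ.<-irrefl same
                  (acyclic⇒outdeg-decreasing A-t acyclic (trans (converse A-t i j i≢j) (cong not ij))))

-- The out-degrees of an acyclic tournament are exactly 0, 1, …, n - 1.
acyclic⇒count-even-outdeg : {A : Digraph n} → IsTournamentᵇ A → Acyclic A →
  count (λ i → not (⨁ (A i))) ≡ ⌈ n /2⌉
acyclic⇒count-even-outdeg {n} {A} A-t acyclic = begin
  count (λ i → not (⨁ (A i)))               ≡⟨ count-cong (λ i → cong not (sym (odd-outdeg≡ i))) ⟩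
  count (λ i → not (odd (toℕ (outdeg′ i))))  ≡⟨ count-∘-injective outdeg′ outdeg′-inj (not ∘ odd ∘ toℕ) ⟩
  count {n} (λ m → not (odd (toℕ m)))        ≡⟨ count-even-toℕ n ⟩
  ⌈ n /2⌉                                    ∎
  where
  open ≡-Reasoning
  outdeg<n : ∀ i → count (A i) < n
  outdeg<n i = count-< (A i) (loopless A-t i)
  outdeg′ : Fin n → Fin n
  outdeg′ i = fromℕ< (outdeg<n i)
  odd-outdeg≡ : ∀ i → odd (toℕ (outdeg′ i)) ≡ ⨁ (A i)
  odd-outdeg≡ i = trans (cong odd (toℕ-fromℕ< (outdeg<n i))) (odd-count (A i))
  outdeg′-inj : Injective _≡_ _≡_ outdeg′
  outdeg′-inj {i} {j} e = acyclic⇒outdeg-injective A-t acyclic i j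
    (trans (sym (toℕ-fromℕ< (outdeg<n i))) (trans (cong toℕ e) (toℕ-fromℕ< (outdeg<n j))))

-- A tournament that agrees with a ranking up to a triangle

module Triangle {ρ : Fin n → ℕ} (ρ-inj : Injective _≡_ _≡_ ρ) {a b c : Fin n}
                (ρa : ρ a ≡ 0) (ρb : ρ b ≡ 1) (ρc : ρ c ≡ 2) where

  private
    R : Digraph n
    R = ranked ρ
    R-t : IsTournamentᵇ R
    R-t = ranked-isTournamentᵇ ρ-inj

  ≢-by-rank : ∀ {v w} → ρ v ≢ ρ w → v ≢ w
  ≢-by-rank ρv≢ρw v≡w = ρv≢ρw (cong ρ v≡w)

  a≢b : a ≢ b
  a≢b = ≢-by-rank λ e → ℕ.0≢1+n (trans (sym ρa) (trans e ρb))

  a≢c : a ≢ c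
  a≢c = ≢-by-rank λ e → ℕ.0≢1+n (trans (sym ρa) (trans e ρc))

  b≢c : b ≢ c
  b≢c = ≢-by-rank λ e → ℕ.0≢1+n (ℕ.suc-injective (trans (sym ρb) (trans e ρc)))

  other≢a : ∀ {v} → 3 ≤ ρ v → v ≢ a
  other≢a ρv≥3 = ≢-by-rank λ e → ℕ.<⇒≢ (ℕ.<-≤-trans (s≤s z≤n) ρv≥3) (sym (trans e ρa))

  other≢b : ∀ {v} → 3 ≤ ρ v → v ≢ b
  other≢b ρv≥3 = ≢-by-rank λ e → ℕ.<⇒≢ (ℕ.<-≤-trans (s≤s (s≤s z≤n)) ρv≥3) (sym (trans e ρb))

  other≢c : ∀ {v} → 3 ≤ ρ v → v ≢ c
  other≢c ρv≥3 = ≢-by-rank λ e → ℕ.<⇒≢ ρv≥3 (sym (trans e ρc))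

  data Role : Fin n → Set where
    role-a     : Role a
    role-b     : Role b
    role-c     : Role c
    role-other : ∀ {v} → 3 ≤ ρ v → Role v

  role : ∀ v → Role v
  role v with ρ v in ρv
  ... | 0 = subst Role (ρ-inj (trans ρa (sym ρv))) role-a
  ... | 1 = subst Role (ρ-inj (trans ρb (sym ρv))) role-b
  ... | 2 = subst Role (ρ-inj (trans ρc (sym ρv))) role-c
  ... | suc (suc (suc _)) = role-other (subst (3 ≤_) (sym ρv) (s≤s (s≤s (s≤s z≤n))))

  inTriangle : Fin n → Bool
  inTriangle v = ρ v <ᵇ 3

  inTriangle-other : ∀ {v} → 3 ≤ ρ v → inTriangle v ≡ false
  inTriangle-other ρv≥3 = <ᵇ-false ρv≥3

  inTriangle-a : inTriangle a ≡ true
  inTriangle-a = cong (_<ᵇ 3) ρa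

  inTriangle-b : inTriangle b ≡ true
  inTriangle-b = cong (_<ᵇ 3) ρb

  inTriangle-c : inTriangle c ≡ true
  inTriangle-c = cong (_<ᵇ 3) ρc

  module _ {D : Digraph n} (D-t : IsTournamentᵇ D)
           (agree-off : ∀ i j → i ≢ b → i ≢ c → j ≢ b → j ≢ c → D i j ≡ R i j)
           (agree-c : ∀ {j} → 3 ≤ ρ j → D c j ≡ R c j)
           (parity : ∀ v → v ≢ a → ⨁ (D v) ≡ ⨁ (R v)) where

    private
      e : Fin n → Fin n → Bool
      e i j = D i j xor R i j

      agreeing : ∀ {i j} → D i j ≡ R i j → e i j ≡ false
      agreeing {i} {j} Dij≡Rij = trans (cong (_xor R i j) Dij≡Rij) (xor-same (R i j))

      e-diag : ∀ i → e i i ≡ false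
      e-diag i = cong₂ _xor_ (loopless D-t i) (loopless R-t i)

      e-sym : ∀ {i j} → i ≢ j → e j i ≡ e i j
      e-sym {i} {j} i≢j = trans (cong₂ _xor_ (converse D-t i j i≢j) (converse R-t i j i≢j))
                                (xor-annihilates-not (D i j) (R i j))

      -- The parity condition at v says that row v of e has an even number of ones.
      row-balance : ∀ {v x y} → v ≢ a → x ≢ y → (∀ j → j ≢ x → j ≢ y → e v j ≡ false) →
        e v x ≡ e v y
      row-balance {v} {x} {y} v≢a x≢y off = xor≡false⇒≡ (begin
        e v x xor e v y       ≡⟨ ⨁-pair (e v) x≢y off ⟨
        ⨁ (e v)               ≡⟨ ⨁-xor (D v) (R v) ⟩
        ⨁ (D v) xor ⨁ (R v)   ≡⟨ cong (_xor ⨁ (R v)) (parity v v≢a) ⟩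
        ⨁ (R v) xor ⨁ (R v)   ≡⟨ xor-same (⨁ (R v)) ⟩
        false                 ∎)
        where
        open ≡-Reasoning
        xor≡false⇒≡ : ∀ {p q} → p xor q ≡ false → p ≡ q
        xor≡false⇒≡ {false} {false} _ = refl
        xor≡false⇒≡ {true}  {true}  _ = refl

      e-other-≢b : ∀ {u} → 3 ≤ ρ u → ∀ j → j ≢ b → e u j ≡ false
      e-other-≢b {u} ρu≥3 j j≢b with role j
      ... | role-a = agreeing (agree-off u a (other≢b ρu≥3) (other≢c ρu≥3) a≢b a≢c)
      ... | role-b = ⊥-elim (j≢b refl)
      ... | role-c = trans (sym (e-sym (other≢c ρu≥3))) (agreeing (agree-c ρu≥3))
      ... | role-other ρj≥3 = agreeing (agree-off u j (other≢b ρu≥3) (other≢c ρu≥3) j≢b (other≢c ρj≥3))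

      -- Off b, row u of e vanishes; balancing it against the diagonal entry e u u clears e u b.
      e-other : ∀ {u} → 3 ≤ ρ u → ∀ j → e u j ≡ false
      e-other {u} ρu≥3 j with j Fin.≟ b
      ... | no j≢b   = e-other-≢b ρu≥3 j j≢b
      ... | yes refl = trans (row-balance (other≢a ρu≥3) (other≢b ρu≥3 ∘ sym)
                                          (λ j j≢b _ → e-other-≢b ρu≥3 j j≢b))
                             (e-diag u)

      e-ca≡e-cb : e c a ≡ e c b
      e-ca≡e-cb = row-balance (a≢c ∘ sym) a≢b off
        where
        off : ∀ j → j ≢ a → j ≢ b → e c j ≡ false
        off j j≢a j≢b with role j
        ... | role-a = ⊥-elim (j≢a refl)
        ... | role-b = ⊥-elim (j≢b refl)
        ... | role-c = e-diag c
        ... | role-other ρj≥3 = agreeing (agree-c ρj≥3)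

      e-ba≡e-bc : e b a ≡ e b c
      e-ba≡e-bc = row-balance (a≢b ∘ sym) a≢c off
        where
        off : ∀ j → j ≢ a → j ≢ c → e b j ≡ false
        off j j≢a j≢c with role j
        ... | role-a = ⊥-elim (j≢a refl)
        ... | role-b = e-diag b
        ... | role-c = ⊥-elim (j≢c refl)
        ... | role-other ρj≥3 = trans (e-sym (other≢b ρj≥3)) (e-other ρj≥3 b)

      t : Bool
      t = e a b

      e-ab : e a b ≡ t
      e-ab = refl
      e-ba : e b a ≡ t
      e-ba = e-sym a≢b
      e-bc : e b c ≡ t
      e-bc = trans (sym e-ba≡e-bc) e-ba
      e-cb : e c b ≡ t
      e-cb = trans (e-sym b≢c) e-bc
      e-ca : e c a ≡ t
      e-ca = trans e-ca≡e-cb e-cb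
      e-ac : e a c ≡ t
      e-ac = trans (e-sym (a≢c ∘ sym)) e-ca

      triangle : ∀ {i j} → inTriangle i ≡ true → inTriangle j ≡ true → e i j ≡ t →
        e i j ≡ t ∧ (inTriangle i ∧ inTriangle j)
      triangle i∈ j∈ eij rewrite i∈ | j∈ = trans eij (sym (∧-identityʳ t))

      e-triangle : ∀ i j → i ≢ j → e i j ≡ t ∧ (inTriangle i ∧ inTriangle j)
      e-triangle i j i≢j with role i | role j
      ... | role-other ρi≥3 | _ rewrite inTriangle-other ρi≥3 =
        trans (e-other ρi≥3 j) (sym (∧-zeroʳ t))
      ... | _ | role-other ρj≥3 rewrite inTriangle-other ρj≥3 | ∧-zeroʳ (inTriangle i) =
        trans (sym (e-sym i≢j)) (trans (e-other ρj≥3 i) (sym (∧-zeroʳ t)))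
      ... | role-a | role-a = ⊥-elim (i≢j refl)
      ... | role-b | role-b = ⊥-elim (i≢j refl)
      ... | role-c | role-c = ⊥-elim (i≢j refl)
      ... | role-a | role-b = triangle inTriangle-a inTriangle-b e-ab
      ... | role-b | role-a = triangle inTriangle-b inTriangle-a e-ba
      ... | role-b | role-c = triangle inTriangle-b inTriangle-c e-bc
      ... | role-c | role-b = triangle inTriangle-c inTriangle-b e-cb
      ... | role-c | role-a = triangle inTriangle-c inTriangle-a e-ca
      ... | role-a | role-c = triangle inTriangle-a inTriangle-c e-ac

      twist : ℕ → ℕ
      twist = reverse₃-if t

      ≡-twisted : ∀ i j → i ≢ j → D i j ≡ ranked (twist ∘ ρ) i j
      ≡-twisted i j i≢j = begin
        D i j                                                ≡⟨ xor-cancel (D i j) (R i j) ⟩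
        R i j xor e i j                                      ≡⟨ cong (R i j xor_) (e-triangle i j i≢j) ⟩
        (ρ j <ᵇ ρ i) xor (t ∧ (inTriangle i ∧ inTriangle j))
                                                             ≡⟨ reverse₃-if-<ᵇ t (ρ i) (ρ j) (i≢j ∘ ρ-inj) ⟨
        twist (ρ j) <ᵇ twist (ρ i)                           ∎
        where
        open ≡-Reasoning
        xor-cancel : ∀ d r → d ≡ r xor (d xor r)
        xor-cancel true  true  = refl
        xor-cancel true  false = refl
        xor-cancel false true  = refl
        xor-cancel false false = refl

    -- All errors lie in the triangle a b c and equal t there, so D ranks by ρ with the ranks 0
    -- and 2 exchanged when t holds.
    acyclic-almost-ranked : Acyclic D
    acyclic-almost-ranked = acyclic-by-rank (reverse₃-if t ∘ ρ) descends
      where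
      descends : ∀ i j → D i j ≡ true → reverse₃-if t (ρ j) < reverse₃-if t (ρ i)
      descends i j Dij with i Fin.≟ j
      ... | yes refl with () ← trans (sym Dij) (loopless D-t i)
      ... | no i≢j = ℕ.<ᵇ⇒< _ _ (subst T (sym (trans (sym (≡-twisted i j i≢j)) Dij)) _)

-- Straightening a tournament by K₂₂-reversals

-- Each arc u → v between vertices outside {b, c} that points up the ranking is reversed by
-- K₂₂ u b v c; afterwards only arcs at b or c can disagree with the ranking, and those from c
-- to the vertices outside the triangle are reversed by K₂₂ c b v a.
module Straighten (q : ℕ) (room : q + 4 ≤ n) {ρ : Fin n → ℕ} (ρ-inj : Injective _≡_ _≡_ ρ)
                  {a b c : Fin n} (ρa : ρ a ≡ 0) (ρb : ρ b ≡ 1) (ρc : ρ c ≡ 2)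
                  {D : Digraph n} (D-t : IsTournamentᵇ D)
                  (parity : ∀ v → v ≢ a → ⨁ (D v) ≡ ⨁ (ranked ρ v)) where

  open Triangle ρ-inj ρa ρb ρc

  private
    R : Digraph n
    R = ranked ρ
    R-t : IsTournamentᵇ R
    R-t = ranked-isTournamentᵇ ρ-inj

  outside : Fin n → Bool
  outside u = not (u ≡ᵇ b) ∧ not (u ≡ᵇ c)

  κ₁ : Fin n → Fin n → Bool
  κ₁ u v = (outside u ∧ outside v) ∧ (D u v ∧ R v u)

  κ₁-distinct : ∀ u v → κ₁ u v ≡ true → Distinct₄ u b v c
  κ₁-distinct u v κ≡true = record
    { u≢x = not-≡ᵇ⇒≢ u≢b ; u≢v = u≢v ; u≢y = not-≡ᵇ⇒≢ u≢c
    ; x≢v = not-≡ᵇ⇒≢ v≢b ∘ sym ; x≢y = b≢c ; v≢y = not-≡ᵇ⇒≢ v≢c }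
    where
    κ-parts = ∧-≡true κ≡true
    uv-outside = ∧-≡true (proj₁ κ-parts)
    u≢b = proj₁ (∧-≡true (proj₁ uv-outside))
    u≢c = proj₂ (∧-≡true (proj₁ uv-outside))
    v≢b = proj₁ (∧-≡true (proj₂ uv-outside))
    v≢c = proj₂ (∧-≡true (proj₂ uv-outside))
    u≢v : u ≢ v
    u≢v refl with () ← trans (sym (proj₂ (∧-≡true (proj₂ κ-parts)))) (loopless R-t u)

  ψ₁ : Pattern n
  ψ₁ i j = ⨁ λ u → ⨁ λ v → κ₁ u v ∧ K₂₂ u b v c i j

  ψ₁-realized : Realizes (2 + q) ψ₁ (λ _ → false)
  ψ₁-realized = realizes-⨁-balanced λ u → realizes-⨁-balanced λ v →
    realizes-K₂₂-if q room (κ₁ u v) (κ₁-distinct u v)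

  D₁ : Digraph n
  D₁ = flipBy ψ₁ D

  D₁-t : IsTournamentᵇ D₁
  D₁-t = flipBy-isTournamentᵇ (symmetric ψ₁-realized) D-t

  D₁-agree : ∀ i j → i ≢ b → i ≢ c → j ≢ b → j ≢ c → D₁ i j ≡ R i j
  D₁-agree i j i≢b i≢c j≢b j≢c with i Fin.≟ j
  ... | yes refl = trans (loopless D₁-t i) (sym (loopless R-t i))
  ... | no i≢j rewrite flipBy-≢ D-t ψ₁ i≢j | ⨁²-K₂₂ κ₁ i≢b i≢c j≢b j≢c
                     | ≡ᵇ-≢ i≢b | ≡ᵇ-≢ i≢c | ≡ᵇ-≢ j≢b | ≡ᵇ-≢ j≢c
    = reverse-misaligned D-t R-t i≢j

  κ₂ : Fin n → Bool
  κ₂ v = not (inTriangle v) ∧ D₁ c v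

  κ₂-distinct : ∀ v → κ₂ v ≡ true → Distinct₄ c b v a
  κ₂-distinct v κ≡true = record
    { u≢x = b≢c ∘ sym ; u≢v = other≢c ρv≥3 ∘ sym ; u≢y = a≢c ∘ sym
    ; x≢v = other≢b ρv≥3 ∘ sym ; x≢y = a≢b ∘ sym ; v≢y = other≢a ρv≥3 }
    where
    ρv≥3 : 3 ≤ ρ v
    ρv≥3 = not-<ᵇ⇒≥ (ρ v) 3 (proj₁ (∧-≡true κ≡true))

  ψ₂ : Pattern n
  ψ₂ i j = ⨁ λ v → κ₂ v ∧ K₂₂ c b v a i j

  ψ₂-realized : Realizes (2 + q) ψ₂ (λ _ → false)
  ψ₂-realized = realizes-⨁-balanced λ v → realizes-K₂₂-if q room (κ₂ v) (κ₂-distinct v)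

  D₂ : Digraph n
  D₂ = flipBy ψ₂ D₁

  D₂-t : IsTournamentᵇ D₂
  D₂-t = flipBy-isTournamentᵇ (symmetric ψ₂-realized) D₁-t

  D₂-agree : ∀ i j → i ≢ b → i ≢ c → j ≢ b → j ≢ c → D₂ i j ≡ R i j
  D₂-agree i j i≢b i≢c j≢b j≢c =
    trans (flipBy-unflipped ψ₂ D₁ ψ₂≡false) (D₁-agree i j i≢b i≢c j≢b j≢c)
    where
    ψ₂≡false : ψ₂ i j ≡ false
    ψ₂≡false = trans (⨁-cong λ v → trans (cong (κ₂ v ∧_) (K₂₂-outside i≢c i≢b j≢c j≢b))
                                         (∧-zeroʳ (κ₂ v)))
                     (⨁-false {n})

  ψ₂-row-c : ∀ {j} → 3 ≤ ρ j → ψ₂ c j ≡ D₁ c j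
  ψ₂-row-c {j} ρj≥3 = begin
    ⨁ (λ v → κ₂ v ∧ K₂₂ c b v a c j)
      ≡⟨ ⨁-cong (λ v → trans (cong (κ₂ v ∧_) K₂₂-c) (∧-comm (κ₂ v) (j ≡ᵇ v))) ⟩
    ⨁ (λ v → (j ≡ᵇ v) ∧ κ₂ v)   ≡⟨ ⨁-δ j κ₂ ⟩
    κ₂ j                        ≡⟨ cong (λ x → not x ∧ D₁ c j) (inTriangle-other ρj≥3) ⟩
    D₁ c j                      ∎
    where
    open ≡-Reasoning
    K₂₂-c : ∀ {v} → K₂₂ c b v a c j ≡ (j ≡ᵇ v)
    K₂₂-c = K₂₂-row (b≢c ∘ sym) (other≢c ρj≥3) (other≢b ρj≥3) (other≢a ρj≥3)

  D₂-agree-c : ∀ {j} → 3 ≤ ρ j → D₂ c j ≡ R c j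
  D₂-agree-c {j} ρj≥3 = begin
    D₂ c j                 ≡⟨ flipBy-≢ D₁-t ψ₂ (other≢c ρj≥3 ∘ sym) ⟩
    D₁ c j xor ψ₂ c j      ≡⟨ cong (D₁ c j xor_) (ψ₂-row-c ρj≥3) ⟩
    D₁ c j xor D₁ c j      ≡⟨ xor-same (D₁ c j) ⟩
    false                  ≡⟨ <ᵇ-false (subst (_≤ ρ j) (sym ρc) (ℕ.≤-trans (ℕ.n≤1+n 2) ρj≥3)) ⟨
    R c j                  ∎
    where open ≡-Reasoning

  D₂-parity : ∀ v → v ≢ a → ⨁ (D₂ v) ≡ ⨁ (R v)
  D₂-parity v v≢a = trans (⨁-flipBy-balanced D₁-t ψ₂-realized v)
                          (trans (⨁-flipBy-balanced D-t ψ₁-realized v) (parity v v≢a))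

  invertible-if-parities-match : Invertible= (2 + q) D
  invertible-if-parities-match =
    invertible-flipBy ψ₁-realized (invertible-flipBy ψ₂-realized (acyclic⇒invertible
      (acyclic-almost-ranked D₂-t D₂-agree D₂-agree-c D₂-parity)))

numEvenOut-if-invertible : {p : ℕ} {T : Digraph n} → IsTournamentᵇ T → odd p ≡ true →
  Invertible= p T → numEvenOut T ≡ ⌈ n /2⌉
numEvenOut-if-invertible {n} {p} {T} T-t odd-p (Xs , sizes , acyclic) = begin
  numEvenOut T                  ≡⟨ numEvenOut≡count T ⟩
  count (λ i → not (⨁ (T i)))   ≡⟨ count-cong (λ i → cong not (sym (parity-kept i))) ⟩
  count (λ i → not (⨁ (A i)))   ≡⟨ acyclic⇒count-even-outdeg A-t A-acyclic ⟩
  ⌈ n /2⌉                       ∎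
  where
  open ≡-Reasoning
  r : Realizes p (reversed Xs) (memberParity Xs)
  r = realizes-sets Xs sizes
  A : Digraph n
  A = flipBy (reversed Xs) T
  A-t : IsTournamentᵇ A
  A-t = flipBy-isTournamentᵇ (symmetric r) T-t
  A-acyclic : Acyclic A
  A-acyclic = acyclic-cong (λ i j → sym (invertAll-flipBy Xs T i j)) acyclic
  parity-kept : ∀ i → ⨁ (A i) ≡ ⨁ (T i)
  parity-kept i rewrite ⨁-flipBy-realized T-t r i | odd-p
    = trans (cong (⨁ (T i) xor_) (∧-zeroʳ (memberParity Xs i))) (xor-identityʳ (⨁ (T i)))

module _ (q : ℕ) (room : q + 4 ≤ n) where

  private
    <n : ∀ {k} → k < 4 → k < n
    <n k<4 = ℕ.<-≤-trans k<4 (ℕ.≤-trans (ℕ.m≤n+m 4 q) room)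
    0<4 : 0 < 4
    0<4 = s≤s z≤n
    1<4 : 1 < 4
    1<4 = s≤s (s≤s z≤n)
    2<4 : 2 < 4
    2<4 = s≤s (s≤s (s≤s z≤n))

  invertible-if-parities-ranked : (σ : Fin n → Fin n) → Injective _≡_ _≡_ σ → {T : Digraph n} →
    IsTournamentᵇ T → (∀ v → 0 < toℕ (σ v) → ⨁ (T v) ≡ odd (toℕ (σ v))) → Invertible= (2 + q) T
  invertible-if-parities-ranked σ σ-inj {T} T-t parity =
    Straighten.invertible-if-parities-match q room (σ-inj ∘ toℕ-injective)
      (rank 0 0<4) (rank 1 1<4) (rank 2 2<4) T-t parity′
    where
    vertexOfRank : ∀ k → k < 4 → Fin n
    vertexOfRank k k<4 = proj₁ (injective⇒surjective σ σ-inj (fromℕ< (<n k<4)))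
    rank : ∀ k (k<4 : k < 4) → toℕ (σ (vertexOfRank k k<4)) ≡ k
    rank k k<4 =
      trans (cong toℕ (proj₂ (injective⇒surjective σ σ-inj (fromℕ< (<n k<4))))) (toℕ-fromℕ< (<n k<4))
    positive : ∀ {v} → v ≢ vertexOfRank 0 0<4 → 0 < toℕ (σ v)
    positive v≢a = ℕ.n≢0⇒n>0 λ σv≡0 → v≢a (σ-inj (toℕ-injective (trans σv≡0 (sym (rank 0 0<4)))))
    parity′ : ∀ v → v ≢ vertexOfRank 0 0<4 → ⨁ (T v) ≡ ⨁ (ranked (toℕ ∘ σ) v)
    parity′ v v≢a = trans (parity v (positive v≢a)) (sym (⨁-ranked-toℕ σ σ-inj v))

  invertible-if-numEvenOut : {T : Digraph n} → IsTournamentᵇ T → numEvenOut T ≡ ⌈ n /2⌉ →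
    Invertible= (2 + q) T
  invertible-if-numEvenOut {T} T-t numEven = invertible-if-parities-ranked σ σ-inj T-t λ v _ →
    not-injective (sym (σ-match v))
    where
    M = matching (λ v → not (⨁ (T v))) (λ m → not (odd (toℕ m)))
      (trans (sym (numEvenOut≡count T)) (trans numEven (sym (count-even-toℕ n))))
    σ : Fin n → Fin n
    σ = proj₁ M
    σ-inj : Injective _≡_ _≡_ σ
    σ-inj = proj₁ (proj₂ M)
    σ-match : ∀ v → not (odd (toℕ (σ v))) ≡ not (⨁ (T v))
    σ-match = proj₂ (proj₂ M)

  -- For even p, first make the out-degree parities those of the ranking toℕ by pair moves
  -- anchored at the vertex of rank 0.
  invertible-if-even : {T : Digraph n} → IsTournamentᵇ T → odd (2 + q) ≡ false → Invertible= (2 + q) T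
  invertible-if-even {T} T-t even =
    invertible-flipBy r₀ (invertible-if-parities-ranked (λ v → v) (λ e → e) T₀-t parity₀)
    where
    a : Fin n
    a = fromℕ< (<n 0<4)
    R : Digraph n
    R = ranked toℕ
    mismatch : Fin n → Bool
    mismatch v = ⨁ (T v) xor ⨁ (R v)
    pair : ∀ v → Σ[ φ ∈ Pattern n ] Realizes (2 + q) φ (λ w → (w ≡ᵇ v) xor (w ≡ᵇ a))
    pair v = realizes-pair (suc q) room′ v a
      where
      room′ : suc q + 2 ≤ n
      room′ = ℕ.≤-trans (ℕ.≤-reflexive (sym (ℕ.+-suc q 2))) (ℕ.≤-trans (ℕ.+-monoʳ-≤ q (ℕ.n≤1+n 3)) room)
    ψ₀ : Pattern n
    ψ₀ i j = ⨁ λ v → mismatch v ∧ proj₁ (pair v) i j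
    r₀ : Realizes (2 + q) ψ₀ (λ w → ⨁ λ v → mismatch v ∧ ((w ≡ᵇ v) xor (w ≡ᵇ a)))
    r₀ = realizes-⨁ λ v → realizes-if (mismatch v) (proj₂ (pair v))
    T₀ : Digraph n
    T₀ = flipBy ψ₀ T
    T₀-t : IsTournamentᵇ T₀
    T₀-t = flipBy-isTournamentᵇ (symmetric r₀) T-t
    parity₀ : ∀ v → 0 < toℕ v → ⨁ (T₀ v) ≡ odd (toℕ v)
    parity₀ v 0<v = begin
      ⨁ (T₀ v)
        ≡⟨ ⨁-flipBy-realized T-t r₀ v ⟩
      ⨁ (T v) xor ((⨁ λ u → mismatch u ∧ ((v ≡ᵇ u) xor (v ≡ᵇ a))) ∧ not (odd (2 + q)))
        ≡⟨ cong (λ x → ⨁ (T v) xor (x ∧ not (odd (2 + q)))) toggled ⟩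
      ⨁ (T v) xor (mismatch v ∧ not (odd (2 + q)))
        ≡⟨ cong (λ o → ⨁ (T v) xor (mismatch v ∧ not o)) even ⟩
      ⨁ (T v) xor (mismatch v ∧ true)
        ≡⟨ cong (⨁ (T v) xor_) (∧-identityʳ (mismatch v)) ⟩
      ⨁ (T v) xor (⨁ (T v) xor ⨁ (R v))
        ≡⟨ xor-assoc (⨁ (T v)) (⨁ (T v)) (⨁ (R v)) ⟨
      (⨁ (T v) xor ⨁ (T v)) xor ⨁ (R v)
        ≡⟨ cong (_xor ⨁ (R v)) (xor-same (⨁ (T v))) ⟩
      ⨁ (R v)
        ≡⟨ ⨁-ranked-toℕ (λ v → v) (λ e → e) v ⟩
      odd (toℕ v) ∎
      where
      open ≡-Reasoning
      v≢a : v ≢ a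
      v≢a v≡a = ℕ.<⇒≢ 0<v (sym (trans (cong toℕ v≡a) (toℕ-fromℕ< (<n 0<4))))
      toggled : (⨁ λ u → mismatch u ∧ ((v ≡ᵇ u) xor (v ≡ᵇ a))) ≡ mismatch v
      toggled rewrite ≡ᵇ-≢ v≢a = trans (⨁-cong λ u → trans (cong (mismatch u ∧_) (xor-identityʳ (v ≡ᵇ u)))
                                                          (∧-comm (mismatch u) (v ≡ᵇ u)))
                                       (⨁-δ v mismatch)

theorem1p3 : (p n : ℕ) → 2 ≤ p → p + 2 ≤ n →
    (T : Digraph n) → IsTournament T →
    Invertible= p T ⇔ ((2 ∣ p) ⊎ (numEvenOut T ≡ ⌈ n /2⌉))
theorem1p3 (suc (suc q)) n (s≤s (s≤s z≤n)) p+2≤n T T-tournament = mk⇔ forward backward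
  where
  T-t : IsTournamentᵇ T
  T-t = isTournament⇒isTournamentᵇ T-tournament
  room : q + 4 ≤ n
  room = ℕ.≤-trans (ℕ.≤-reflexive (trans (ℕ.+-suc q 3) (cong suc (ℕ.+-suc q 2)))) p+2≤n
  forward : Invertible= (2 + q) T → (2 ∣ 2 + q) ⊎ (numEvenOut T ≡ ⌈ n /2⌉)
  forward invertible with 2 ∣? (2 + q)
  ... | yes 2∣p = inj₁ 2∣p
  ... | no 2∤p  = inj₂ (numEvenOut-if-invertible T-t (2∤⇒odd 2∤p) invertible)
  backward : (2 ∣ 2 + q) ⊎ (numEvenOut T ≡ ⌈ n /2⌉) → Invertible= (2 + q) T
  backward (inj₁ 2∣p)     = invertible-if-even q room T-t (2∣⇒even 2∣p)
  backward (inj₂ numEven) = invertible-if-numEvenOut q room T-t numEven
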